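{- Let $k\geqslant1$ and let $n$ be an even positive integer. Let $\mathrm{SB}^+_{2^k}(n)$ denote the set of self-dual generalized bent functions $\mathbb{F}_2^n\to\mathbb{Z}_{2^k}$ and $\mathrm{SB}^+_2(n)$ the set of self-dual Boolean bent functions in $n$ variables. Then $|\mathrm{SB}^+_{2^k}(n)|\leqslant|\mathrm{SB}^+_2(n)|^k$.
   Context: For $q$ even, $\omega=e^{2\pi i/q}$ and $f:\mathbb{F}_2^n\to\mathbb{Z}_q$, $H_f(y)=\sum_x\omega^{f(x)}(-1)^{\langle x,y\rangle}$; $f$ is self-dual generalized bent if $H_f(y)=2^{n/2}\omega^{f(y)}$ for all $y$. For $q=2$ this is the usual notion of a self-dual Boolean bent function. -}

module Defs where

open import Data.Bool using (Bool; true; false; _∧_; _xor_; if_then_else_)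
open import Data.Nat using (ℕ; zero; suc; _^_; _∸_; _+_; _≡ᵇ_)
open import Data.Integer as ℤ using (ℤ; +_; -_)
open import Data.Fin using (Fin; toℕ)
open import Data.Vec as Vec using (Vec; []; _∷_; tabulate; zipWith; replicate; foldr)
open import Data.Vec.Properties using (≡-dec)
open import Data.List as List using (List; length; filter; concatMap)
open import Data.Product using (_×_; _,_)
open import Relation.Nullary using (Dec; yes; no)
open import Relation.Binary.PropositionalEquality using (_≡_)

-- Elements of Z[ω], ω = e^{2πi/2^k} (k ≥ 1), represented exactly as
-- coefficient vectors w.r.t. the Z-basis 1, ω, …, ω^{m-1}, m = 2^{k-1}
-- (Z[ω] ≅ Z[X]/(X^m + 1)).
half : ℕ → ℕ
half k = 2 ^ (k ∸ 1)

Zω : ℕ → Set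
Zω k = Vec ℤ (half k)

ωpow : (k : ℕ) → Fin (2 ^ k) → Zω k
ωpow k j = tabulate λ i →
  if toℕ j ≡ᵇ toℕ i then + 1
  else if toℕ j ≡ᵇ (toℕ i + half k) then - (+ 1)
  else + 0

zeroω : (k : ℕ) → Zω k
zeroω k = replicate _ (+ 0)

addω : (k : ℕ) → Zω k → Zω k → Zω k
addω k = zipWith ℤ._+_

negω : (k : ℕ) → Zω k → Zω k
negω k = Vec.map -_

scaleω : (k : ℕ) → ℤ → Zω k → Zω k
scaleω k c = Vec.map (c ℤ.*_)

dot : {n : ℕ} → Vec Bool n → Vec Bool n → Bool
dot x y = foldr _ _xor_ false (zipWith _∧_ x y)

allVecs : (n : ℕ) → List (Vec Bool n)
allVecs zero = [] List.∷ List.[]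
allVecs (suc n) = List.map (false ∷_) (allVecs n) List.++ List.map (true ∷_) (allVecs n)

H : (k n : ℕ) → (Vec Bool n → Fin (2 ^ k)) → Vec Bool n → Zω k
H k n f y = List.foldr (λ x acc → addω k (if dot x y then negω k (ωpow k (f x)) else ωpow k (f x)) acc)
                       (zeroω k) (allVecs n)

SelfDualBent : (k n h : ℕ) → (Vec Bool n → Fin (2 ^ k)) → Set
SelfDualBent k n h f = ∀ y → H k n f y ≡ scaleω k (+ (2 ^ h)) (ωpow k (f y))

-- Enumeration of all functions F_2^n → A (each function exactly once up to
-- extensional equality), by splitting on the first coordinate.
allFuns : {A : Set} → List A → (n : ℕ) → List (Vec Bool n → A)
allFuns as zero = List.map (λ a _ → a) as
allFuns as (suc n) =
  concatMap (λ g → List.map (λ h → split g h) (allFuns as n)) (allFuns as n)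
  where
    split : _ → _ → Vec Bool (suc n) → _
    split g h (false ∷ v) = g v
    split g h (true ∷ v) = h v

decAll : (n : ℕ) {P : Vec Bool n → Set} → (∀ v → Dec (P v)) → Dec (∀ v → P v)
decAll zero P? with P? []
... | yes p = yes λ { [] → p }
... | no ¬p = no λ h → ¬p (h [])
decAll (suc n) {P} P? with decAll n (λ v → P? (false ∷ v)) | decAll n (λ v → P? (true ∷ v))
... | yes p | yes q = yes λ { (false ∷ v) → p v ; (true ∷ v) → q v }
... | no ¬p | _ = no λ h → ¬p (λ v → h (false ∷ v))
... | yes _ | no ¬q = no λ h → ¬q (λ v → h (true ∷ v))

selfDualBent? : (k n h : ℕ) → (f : Vec Bool n → Fin (2 ^ k)) → Dec (SelfDualBent k n h f)
selfDualBent? k n h f = decAll n (λ y → ≡-dec ℤ._≟_ (H k n f y) _)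

-- |SB^+_{2^k}(n)| with n = 2h
numSB : (k n h : ℕ) → ℕ
numSB k n h = length (filter (selfDualBent? k n h) (allFuns (List.allFin (2 ^ k)) n))

{-# OPTIONS --safe #-}

-- A ℤ-linear map ℤ[ω] → ℤ[ω′] sending every root of unity ω^j to a root ω′^(ψ j)
-- commutes with the Walsh–Hadamard sums and with the scaling by 2^h, so it turns a
-- self-dual bent f into the self-dual bent ψ ∘ f. For q = 2^(k+2) write
-- j = 2^(k+1) s + 2^k b + r. Maps sending each basis vector ω^p to ± a basis vector
-- give two such ψ's, one into ℤ_(2^(k+1)) forgetting b, the other into ℤ_2 recording
-- b ⊕ s; together they determine j. Hence f ↦ (ψ₁ ∘ f , ψ₂ ∘ f) embeds SB_(2^(k+2)) into
-- SB_(2^(k+1)) × SB_2, and induction on k gives the bound.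
module Submission where

open import Defs
open import Data.Nat using (ℕ; zero; suc; _≤_; _<_; _*_; _^_; _+_; _≡ᵇ_)
open import Data.Nat.Properties
  using (_≟_; <⇒≢; >⇒≢; <-≤-trans; m≤n+m; m≤m+n; +-comm; ≤-reflexive; *-identityʳ; *-monoˡ-≤; *-comm; module ≤-Reasoning)
open import Data.Bool using (Bool; true; false; if_then_else_)
open import Data.Integer as ℤ using (ℤ; +_; -_; 0ℤ; 1ℤ; -1ℤ)
open import Data.Integer.Properties using (+-*-semiring; *-commutativeSemigroup; -1*i≡-i; *-zeroʳ; +-identityʳ; +-identityˡ; *-distribˡ-+)
open import Algebra.Properties.Semiring.Sum +-*-semiring using (sum-syntax; sum-cong-≗; ∑-distrib-+; *-distribˡ-sum; sum-replicate-zero)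
open import Algebra.Properties.CommutativeSemigroup *-commutativeSemigroup using (x∙yz≈y∙xz)
open import Data.Fin using (Fin; zero; suc; toℕ; combine; quotient; remainder; _↑ˡ_)
open import Data.Fin.Properties
  using (toℕ-↑ˡ; toℕ-↑ʳ; toℕ<n; combine-remQuot; combine-injectiveˡ; combine-injectiveʳ; injective⇒≤)
open import Data.Vec using (Vec; []; _∷_; tabulate; zipWith)
import Data.Vec as Vec
open import Data.Vec.Properties using (tabulate-cong; lookup∘tabulate; lookup-zipWith; lookup-map; map-cong; map-const; tabulate-∘)
open import Data.List using (List; []; _∷_; _++_; length; lookup; map; filter; concatMap; cartesianProduct; cartesianProductWith; allFin)
import Data.List as List
open import Data.List.Properties using (length-map; length-++)
import Data.List.Relation.Unary.All as All
open import Data.List.Relation.Unary.AllPairs using (_∷_)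
open import Data.List.Membership.Propositional.Properties using (∈-lookup; ∈-allFin)
import Data.List.Membership.Setoid as SetoidMembership
import Data.List.Membership.Setoid.Properties as SetoidMembershipₚ
open import Data.List.Relation.Binary.Subset.Setoid using (_⊆_)
open import Data.List.Relation.Unary.Unique.Setoid using (Unique)
import Data.List.Relation.Unary.Unique.Setoid.Properties as Uniqueₚ
open import Data.List.Relation.Unary.Unique.Propositional.Properties using (allFin⁺)
open import Data.Product using (_×_; _,_; proj₂)
open import Data.Product.Relation.Binary.Pointwise.NonDependent using (_×ₛ_)
open import Function using (id; _∘_)
open import Relation.Binary.Bundles using (Setoid)
open import Relation.Binary.PropositionalEquality
  using (_≡_; _≢_; _≗_; refl; sym; trans; cong; cong₂; subst; setoid; _→-setoid_; module ≡-Reasoning)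
open import Relation.Nullary using (contradiction)
open import Relation.Nullary.Decidable using (dec-false)

module _ {a ℓ} (S : Setoid a ℓ) where
  open Setoid S using (_≈_) renaming (sym to ≈-sym)

  Unique⇒lookup-injective : ∀ {xs} → Unique S xs → ∀ i j → lookup xs i ≈ lookup xs j → i ≡ j
  Unique⇒lookup-injective (_  ∷ _)   zero    zero    _   = refl
  Unique⇒lookup-injective (x≉ ∷ _)   zero    (suc j) x≈y = contradiction x≈y (All.lookup x≉ (∈-lookup j))
  Unique⇒lookup-injective (x≉ ∷ _)   (suc i) zero    y≈x = contradiction (≈-sym y≈x) (All.lookup x≉ (∈-lookup i))
  Unique⇒lookup-injective (_  ∷ xs!) (suc i) (suc j) eq  = cong suc (Unique⇒lookup-injective xs! i j eq)

  Unique-⊆⇒length≤ : ∀ {xs ys} → Unique S xs → _⊆_ S xs ys → length xs ≤ length ys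
  Unique-⊆⇒length≤ {xs} xs! xs⊆ys = injective⇒≤ λ {i} {j} index≡ →
    Unique⇒lookup-injective xs! i j
      (SetoidMembershipₚ.index-injective S (xs⊆ys (∈-lookupₛ i)) (xs⊆ys (∈-lookupₛ j)) index≡)
    where ∈-lookupₛ = SetoidMembershipₚ.∈-lookup S xs

length-cartesianProduct : ∀ {A B : Set} (xs : List A) (ys : List B) →
  length (cartesianProduct xs ys) ≡ length xs * length ys
length-cartesianProduct []       ys = refl
length-cartesianProduct (x ∷ xs) ys =
  trans (length-++ (map (x ,_) ys)) (cong₂ _+_ (length-map (x ,_) ys) (length-cartesianProduct xs ys))

concatMap-map≡cartesianProductWith : ∀ {A B C : Set} (f : A → B → C) xs ys →
  concatMap (λ x → map (f x) ys) xs ≡ cartesianProductWith f xs ys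
concatMap-map≡cartesianProductWith f []       ys = refl
concatMap-map≡cartesianProductWith f (x ∷ xs) ys =
  cong (map (f x) ys ++_) (concatMap-map≡cartesianProductWith f xs ys)

FunSetoid : ℕ → Set → Setoid _ _
FunSetoid n A = Vec Bool n →-setoid A

module _ {A : Set} where
  open SetoidMembership using (_∈_)

  allFuns-unique : ∀ {as} → Unique (setoid A) as → ∀ n → Unique (FunSetoid n A) (allFuns as n)
  allFuns-unique as! zero = Uniqueₚ.map⁺ (setoid A) (FunSetoid zero A) (λ f≗g → f≗g []) as!
  allFuns-unique {as} as! (suc n) =
    subst (Unique (FunSetoid (suc n) A)) (sym (concatMap-map≡cartesianProductWith _ (allFuns as n) (allFuns as n)))
      (Uniqueₚ.cartesianProductWith⁺ (FunSetoid n A) (FunSetoid n A) (FunSetoid (suc n) A) _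
         (λ f≗g → (λ v → f≗g (false ∷ v)) , (λ v → f≗g (true ∷ v)))
         (allFuns-unique as! n) (allFuns-unique as! n))

  ∈-allFuns : ∀ {as} → (∀ a → _∈_ (setoid A) a as) → ∀ n f → _∈_ (FunSetoid n A) f (allFuns as n)
  ∈-allFuns ∈as zero f = SetoidMembershipₚ.∈-resp-≈ (FunSetoid zero A) (λ { [] → refl })
    (SetoidMembershipₚ.∈-map⁺ (setoid A) (FunSetoid zero A) (λ a≡b _ → a≡b) (∈as (f [])))
  ∈-allFuns {as} ∈as (suc n) f =
    subst (_∈_ (FunSetoid (suc n) A) f) (sym (concatMap-map≡cartesianProductWith _ (allFuns as n) (allFuns as n)))
      (SetoidMembershipₚ.∈-resp-≈ (FunSetoid (suc n) A) (λ { (false ∷ v) → refl ; (true ∷ v) → refl })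
        (SetoidMembershipₚ.∈-cartesianProductWith⁺ (FunSetoid n A) (FunSetoid n A) (FunSetoid (suc n) A)
          (λ g≗g′ h≗h′ → λ { (false ∷ v) → g≗g′ v ; (true ∷ v) → h≗h′ v })
          (∈-allFuns ∈as n (λ v → f (false ∷ v))) (∈-allFuns ∈as n (λ v → f (true ∷ v)))))

record IsLinear {k k′ : ℕ} (L : Zω k → Zω k′) : Set where
  field
    +-homo     : ∀ a b → L (addω k a b) ≡ addω k′ (L a) (L b)
    scale-homo : ∀ c a → L (scaleω k c a) ≡ scaleω k′ c (L a)

  open ≡-Reasoning

  neg-homo : ∀ a → L (negω k a) ≡ negω k′ (L a)
  neg-homo a = begin
    L (negω k a)        ≡⟨ cong L (negω≡scaleω-1 a) ⟩
    L (scaleω k -1ℤ a)  ≡⟨ scale-homo -1ℤ a ⟩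
    scaleω k′ -1ℤ (L a) ≡⟨ negω≡scaleω-1 (L a) ⟨
    negω k′ (L a)       ∎
    where
    negω≡scaleω-1 : ∀ {m} (v : Vec ℤ m) → Vec.map -_ v ≡ Vec.map (-1ℤ ℤ.*_) v
    negω≡scaleω-1 = map-cong (sym ∘ -1*i≡-i)

  zero-homo : L (zeroω k) ≡ zeroω k′
  zero-homo = begin
    L (zeroω k)                ≡⟨ cong L (map-const (zeroω k) 0ℤ) ⟨
    L (scaleω k 0ℤ (zeroω k))  ≡⟨ scale-homo 0ℤ (zeroω k) ⟩
    scaleω k′ 0ℤ (L (zeroω k)) ≡⟨ map-const (L (zeroω k)) 0ℤ ⟩
    zeroω k′                   ∎

id-isLinear : ∀ {k} → IsLinear {k} {k} id
id-isLinear = record { +-homo = λ _ _ → refl ; scale-homo = λ _ _ → refl }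

zipWith-tabulate : ∀ {A B C : Set} {m} (f : A → B → C) (g : Fin m → A) (h : Fin m → B) →
  zipWith f (tabulate g) (tabulate h) ≡ tabulate (λ i → f (g i) (h i))
zipWith-tabulate {m = zero}  f g h = refl
zipWith-tabulate {m = suc m} f g h = cong (f (g zero) (h zero) ∷_) (zipWith-tabulate f (g ∘ suc) (h ∘ suc))

matrixAction : ∀ {m m′} → (Fin m′ → Fin m → ℤ) → Vec ℤ m → Vec ℤ m′
matrixAction {m} A v = tabulate λ q → ∑[ p < m ] (A q p ℤ.* Vec.lookup v p)

matrixAction-isLinear : ∀ {k k′} (A : Fin (half k′) → Fin (half k) → ℤ) → IsLinear {k} {k′} (matrixAction A)
matrixAction-isLinear {k} {k′} A = record { +-homo = +-homo ; scale-homo = scale-homo }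
  where
  open ≡-Reasoning
  Av : Vec ℤ (half k) → Fin (half k′) → Fin (half k) → ℤ
  Av v q p = A q p ℤ.* Vec.lookup v p

  +-homo : ∀ a b → matrixAction A (addω k a b) ≡ addω k′ (matrixAction A a) (matrixAction A b)
  +-homo a b = begin
    matrixAction A (zipWith ℤ._+_ a b)
      ≡⟨ tabulate-cong (λ q → sum-cong-≗ λ p →
           trans (cong (A q p ℤ.*_) (lookup-zipWith ℤ._+_ p a b)) (*-distribˡ-+ (A q p) _ _)) ⟩
    tabulate (λ q → ∑[ p < half k ] (Av a q p ℤ.+ Av b q p))
      ≡⟨ tabulate-cong (λ q → ∑-distrib-+ (Av a q) (Av b q)) ⟩
    tabulate (λ q → (∑[ p < half k ] Av a q p) ℤ.+ (∑[ p < half k ] Av b q p))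
      ≡⟨ zipWith-tabulate ℤ._+_ _ _ ⟨
    zipWith ℤ._+_ (matrixAction A a) (matrixAction A b) ∎

  scale-homo : ∀ c a → matrixAction A (scaleω k c a) ≡ scaleω k′ c (matrixAction A a)
  scale-homo c a = begin
    matrixAction A (Vec.map (c ℤ.*_) a)
      ≡⟨ tabulate-cong (λ q → sum-cong-≗ λ p →
           trans (cong (A q p ℤ.*_) (lookup-map p (c ℤ.*_) a)) (x∙yz≈y∙xz (A q p) c _)) ⟩
    tabulate (λ q → ∑[ p < half k ] (c ℤ.* Av a q p))
      ≡⟨ tabulate-cong (λ q → *-distribˡ-sum c (Av a q)) ⟨
    tabulate (λ q → c ℤ.* (∑[ p < half k ] Av a q p))
      ≡⟨ tabulate-∘ (c ℤ.*_) _ ⟩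
    Vec.map (c ℤ.*_) (matrixAction A a) ∎

walshTerm : ∀ k → Fin (2 ^ k) → Bool → Zω k
walshTerm k j b = if b then negω k (ωpow k j) else ωpow k j

-- H k n f y is definitionally walshSum k f y (allVecs n).
walshSum : ∀ k {n} → (Vec Bool n → Fin (2 ^ k)) → Vec Bool n → List (Vec Bool n) → Zω k
walshSum k f y = List.foldr (λ x acc → addω k (walshTerm k (f x) (dot x y)) acc) (zeroω k)

module _ {k k′ n} {L : Zω k → Zω k′} (L-isLinear : IsLinear {k} {k′} L)
         {f : Vec Bool n → Fin (2 ^ k)} {g : Vec Bool n → Fin (2 ^ k′)}
         (L-ωpow : ∀ x → L (ωpow k (f x)) ≡ ωpow k′ (g x)) where
  open IsLinear L-isLinear

  walshTerm-transport : ∀ x b → L (walshTerm k (f x) b) ≡ walshTerm k′ (g x) b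
  walshTerm-transport x true  = trans (neg-homo _) (cong (negω k′) (L-ωpow x))
  walshTerm-transport x false = L-ωpow x

  walshSum-transport : ∀ y xs → L (walshSum k f y xs) ≡ walshSum k′ g y xs
  walshSum-transport y []       = zero-homo
  walshSum-transport y (x ∷ xs) = trans (+-homo _ _)
    (cong₂ (addω k′) (walshTerm-transport x (dot x y)) (walshSum-transport y xs))

  selfDualBent-transport : ∀ {h} → SelfDualBent k n h f → SelfDualBent k′ n h g
  selfDualBent-transport {h} f-sd y = begin
    H k′ n g y                             ≡⟨ walshSum-transport y (allVecs n) ⟨
    L (H k n f y)                          ≡⟨ cong L (f-sd y) ⟩
    L (scaleω k (+ 2 ^ h) (ωpow k (f y)))  ≡⟨ scale-homo (+ 2 ^ h) _ ⟩
    scaleω k′ (+ 2 ^ h) (L (ωpow k (f y))) ≡⟨ cong (scaleω k′ (+ 2 ^ h)) (L-ωpow y) ⟩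
    scaleω k′ (+ 2 ^ h) (ωpow k′ (g y))    ∎
    where open ≡-Reasoning

selfDualBent-resp-≗ : ∀ {k n h} {f g : Vec Bool n → Fin (2 ^ k)} → f ≗ g → SelfDualBent k n h f → SelfDualBent k n h g
selfDualBent-resp-≗ {k} {n} {h} {f} {g} f≗g = selfDualBent-transport (id-isLinear {k}) {f} {g} (cong (ωpow k) ∘ f≗g) {h}

sign : Fin 2 → ℤ
sign zero       = 1ℤ
sign (suc zero) = -1ℤ

infixl 6 _⊕_
_⊕_ : Fin 2 → Fin 2 → Fin 2
zero     ⊕ t        = t
suc zero ⊕ zero     = suc zero
suc zero ⊕ suc zero = zero

sign-⊕ : ∀ s t → sign (s ⊕ t) ≡ sign s ℤ.* sign t
sign-⊕ zero       zero       = refl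
sign-⊕ zero       (suc zero) = refl
sign-⊕ (suc zero) zero       = refl
sign-⊕ (suc zero) (suc zero) = refl

⊕-cancelʳ : ∀ {s s′} t → s ⊕ t ≡ s′ ⊕ t → s ≡ s′
⊕-cancelʳ {zero}     {zero}     _          _  = refl
⊕-cancelʳ {suc zero} {suc zero} _          _  = refl
⊕-cancelʳ {zero}     {suc zero} zero       ()
⊕-cancelʳ {zero}     {suc zero} (suc zero) ()
⊕-cancelʳ {suc zero} {zero}     zero       ()
⊕-cancelʳ {suc zero} {zero}     (suc zero) ()

signedBasis : ∀ {m} → Fin 2 → Fin m → Vec ℤ m
signedBasis s p = tabulate λ i → if toℕ p ≡ᵇ toℕ i then sign s else 0ℤ

lookup-signedBasis : ∀ {m} s (p i : Fin m) → Vec.lookup (signedBasis s p) i ≡ (if toℕ p ≡ᵇ toℕ i then sign s else 0ℤ)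
lookup-signedBasis s p = lookup∘tabulate _

≢⇒≡ᵇ-false : ∀ {m n} → m ≢ n → (m ≡ᵇ n) ≡ false
≢⇒≡ᵇ-false {m} {n} = dec-false (m ≟ n)

+-cancelˡ-≡ᵇ : ∀ m n o → (m + n ≡ᵇ m + o) ≡ (n ≡ᵇ o)
+-cancelˡ-≡ᵇ zero    n o = refl
+-cancelˡ-≡ᵇ (suc m) n o = +-cancelˡ-≡ᵇ m n o

ωpow-combine : ∀ k (s : Fin 2) (p : Fin (2 ^ k)) → ωpow (suc k) (combine s p) ≡ signedBasis s p
ωpow-combine k s p = tabulate-cong (coefficient s)
  where
  M = 2 ^ k
  coefficient : ∀ s i →
    (if toℕ (combine s p) ≡ᵇ toℕ i then 1ℤ else if toℕ (combine s p) ≡ᵇ toℕ i + M then -1ℤ else 0ℤ)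
      ≡ (if toℕ p ≡ᵇ toℕ i then sign s else 0ℤ)
  coefficient zero i rewrite toℕ-↑ˡ p (1 * M) with toℕ p ≡ᵇ toℕ i
  ... | true  = refl
  ... | false rewrite ≢⇒≡ᵇ-false (<⇒≢ (<-≤-trans (toℕ<n p) (m≤n+m M (toℕ i)))) = refl
  coefficient (suc zero) i rewrite toℕ-↑ʳ M (p ↑ˡ 0) | toℕ-↑ˡ p 0
    | ≢⇒≡ᵇ-false (>⇒≢ (<-≤-trans (toℕ<n i) (m≤m+n M (toℕ p))))
    | +-comm (toℕ i) M | +-cancelˡ-≡ᵇ M (toℕ p) (toℕ i) = refl

∑-δ : ∀ {m} (g : Fin m → ℤ) (p : Fin m) c →
  ∑[ i < m ] (g i ℤ.* (if toℕ p ≡ᵇ toℕ i then c else 0ℤ)) ≡ g p ℤ.* c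
∑-δ {suc m} g zero c = begin
  g zero ℤ.* c ℤ.+ (∑[ i < m ] (g (suc i) ℤ.* 0ℤ))
    ≡⟨ cong (ℤ._+_ (g zero ℤ.* c)) (trans (sum-cong-≗ (*-zeroʳ ∘ g ∘ suc)) (sum-replicate-zero m)) ⟩
  g zero ℤ.* c ℤ.+ 0ℤ
    ≡⟨ +-identityʳ _ ⟩
  g zero ℤ.* c ∎
  where open ≡-Reasoning
∑-δ {suc m} g (suc p) c = trans (cong₂ ℤ._+_ (*-zeroʳ (g zero)) (∑-δ (g ∘ suc) p c)) (+-identityˡ _)

matrixAction-signedBasis : ∀ {m m′} (A : Fin m′ → Fin m → ℤ) s p →
  matrixAction A (signedBasis s p) ≡ tabulate (λ q → A q p ℤ.* sign s)
matrixAction-signedBasis A s p = tabulate-cong λ q →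
  trans (sum-cong-≗ λ i → cong (A q i ℤ.*_) (lookup-signedBasis s p i)) (∑-δ (A q) p (sign s))

-- signedMap sends the basis vector ω^p (p < 2^k) to ± ω′^(ρ p), the sign being given by σ p;
-- since ω^(2^k s + p) = ± ω^p, it sends every root of unity ω^j to ω′^(reindex j).
module SignedMap {k k′ : ℕ} (σ : Fin (2 ^ k) → Fin 2) (ρ : Fin (2 ^ k) → Fin (2 ^ k′)) where

  signedMatrix : Fin (2 ^ k′) → Fin (2 ^ k) → ℤ
  signedMatrix q p = Vec.lookup (signedBasis (σ p) (ρ p)) q

  signedMap : Zω (suc k) → Zω (suc k′)
  signedMap = matrixAction signedMatrix

  signedMap-signedBasis : ∀ s p → signedMap (signedBasis s p) ≡ signedBasis (σ p ⊕ s) (ρ p)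
  signedMap-signedBasis s p = trans (matrixAction-signedBasis signedMatrix s p) (tabulate-cong λ q →
    trans (cong (ℤ._* sign s) (lookup-signedBasis (σ p) (ρ p) q)) (coefficient (toℕ (ρ p) ≡ᵇ toℕ q)))
    where
    coefficient : ∀ b → (if b then sign (σ p) else 0ℤ) ℤ.* sign s ≡ (if b then sign (σ p ⊕ s) else 0ℤ)
    coefficient true  = sym (sign-⊕ (σ p) s)
    coefficient false = refl

  reindex : Fin (2 ^ suc k) → Fin (2 ^ suc k′)
  reindex j = combine (σ (remainder {2} (2 ^ k) j) ⊕ quotient {2} (2 ^ k) j) (ρ (remainder {2} (2 ^ k) j))

  signedMap-ωpow : ∀ j → signedMap (ωpow (suc k) j) ≡ ωpow (suc k′) (reindex j)
  signedMap-ωpow j = begin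
    signedMap (ωpow (suc k) j)             ≡⟨ cong (signedMap ∘ ωpow (suc k)) (combine-remQuot {2} (2 ^ k) j) ⟨
    signedMap (ωpow (suc k) (combine s p)) ≡⟨ cong signedMap (ωpow-combine k s p) ⟩
    signedMap (signedBasis s p)            ≡⟨ signedMap-signedBasis s p ⟩
    signedBasis (σ p ⊕ s) (ρ p)            ≡⟨ ωpow-combine k′ (σ p ⊕ s) (ρ p) ⟨
    ωpow (suc k′) (reindex j)              ∎
    where
    open ≡-Reasoning
    s = quotient {2} (2 ^ k) j
    p = remainder {2} (2 ^ k) j

  reindex-selfDualBent : ∀ {n h f} → SelfDualBent (suc k) n h f → SelfDualBent (suc k′) n h (reindex ∘ f)
  reindex-selfDualBent {n} {h} {f} =
    selfDualBent-transport (matrixAction-isLinear {suc k} {suc k′} signedMatrix) {f} {reindex ∘ f} (signedMap-ωpow ∘ f) {h}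

SB : ∀ k n h → List (Vec Bool n → Fin (2 ^ k))
SB k n h = filter (selfDualBent? k n h) (allFuns (allFin (2 ^ k)) n)

module _ (k n h : ℕ) where
  open SetoidMembership (FunSetoid n (Fin (2 ^ k))) using (_∈_)

  SB-unique : Unique (FunSetoid n (Fin (2 ^ k))) (SB k n h)
  SB-unique = Uniqueₚ.filter⁺ (FunSetoid n (Fin (2 ^ k))) (selfDualBent? k n h) (allFuns-unique (allFin⁺ (2 ^ k)) n)

  ∈-SB⁺ : ∀ {f} → SelfDualBent k n h f → f ∈ SB k n h
  ∈-SB⁺ = SetoidMembershipₚ.∈-filter⁺ (FunSetoid n (Fin (2 ^ k))) (selfDualBent? k n h) (selfDualBent-resp-≗ {k} {n} {h})
    (∈-allFuns ∈-allFin n _)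

  ∈-SB⁻ : ∀ {f} → f ∈ SB k n h → SelfDualBent k n h f
  ∈-SB⁻ = proj₂ ∘ SetoidMembershipₚ.∈-filter⁻ (FunSetoid n (Fin (2 ^ k))) (selfDualBent? k n h) (selfDualBent-resp-≗ {k} {n} {h})
    {xs = allFuns (allFin (2 ^ k)) n}

numSB-≤-* : ∀ {k k₁ k₂} n h (ψ₁ : Fin (2 ^ k) → Fin (2 ^ k₁)) (ψ₂ : Fin (2 ^ k) → Fin (2 ^ k₂)) →
  (∀ {f} → SelfDualBent k n h f → SelfDualBent k₁ n h (ψ₁ ∘ f)) →
  (∀ {f} → SelfDualBent k n h f → SelfDualBent k₂ n h (ψ₂ ∘ f)) →
  (∀ {i j} → ψ₁ i ≡ ψ₁ j → ψ₂ i ≡ ψ₂ j → i ≡ j) →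
  numSB k n h ≤ numSB k₁ n h * numSB k₂ n h
numSB-≤-* {k} {k₁} {k₂} n h ψ₁ ψ₂ ψ₁-sd ψ₂-sd ψ-injective = begin
  numSB k n h                                       ≡⟨ length-map Ψ (SB k n h) ⟨
  length (map Ψ (SB k n h))                         ≤⟨ Unique-⊆⇒length≤ Pairs Ψ[SB]-unique Ψ[SB]⊆SB×SB ⟩
  length (cartesianProduct (SB k₁ n h) (SB k₂ n h)) ≡⟨ length-cartesianProduct (SB k₁ n h) (SB k₂ n h) ⟩
  numSB k₁ n h * numSB k₂ n h                       ∎
  where
  open ≤-Reasoning
  Funs = FunSetoid n (Fin (2 ^ k))
  Pairs = FunSetoid n (Fin (2 ^ k₁)) ×ₛ FunSetoid n (Fin (2 ^ k₂))
  open SetoidMembership Pairs using (_∈_)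

  Ψ : (Vec Bool n → Fin (2 ^ k)) → (Vec Bool n → Fin (2 ^ k₁)) × (Vec Bool n → Fin (2 ^ k₂))
  Ψ f = ψ₁ ∘ f , ψ₂ ∘ f

  Ψ[SB]-unique : Unique Pairs (map Ψ (SB k n h))
  Ψ[SB]-unique = Uniqueₚ.map⁺ Funs Pairs (λ (e₁ , e₂) x → ψ-injective (e₁ x) (e₂ x)) (SB-unique k n h)

  Ψ[SB]⊆SB×SB : ∀ {p} → p ∈ map Ψ (SB k n h) → p ∈ cartesianProduct (SB k₁ n h) (SB k₂ n h)
  Ψ[SB]⊆SB×SB p∈ with f , f∈SB , p≈Ψf ← SetoidMembershipₚ.∈-map⁻ Funs Pairs p∈ =
    SetoidMembershipₚ.∈-resp-≈ Pairs (Setoid.sym Pairs p≈Ψf)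
      (SetoidMembershipₚ.∈-cartesianProduct⁺ (FunSetoid n (Fin (2 ^ k₁))) (FunSetoid n (Fin (2 ^ k₂)))
        (∈-SB⁺ k₁ n h (ψ₁-sd f-sd)) (∈-SB⁺ k₂ n h (ψ₂-sd f-sd)))
    where f-sd = ∈-SB⁻ k n h f∈SB

quotient-remainder-injective : ∀ {m} n {i j : Fin (m * n)} →
  quotient {m} n i ≡ quotient {m} n j → remainder {m} n i ≡ remainder {m} n j → i ≡ j
quotient-remainder-injective {m} n {i} {j} q≡ r≡ =
  trans (sym (combine-remQuot {m} n i)) (trans (cong₂ combine q≡ r≡) (combine-remQuot {m} n j))

-- For j = 2^(k+1) s + 2^k b + r: deleteBit j = 2^k s + r and xorTopBits j = b ⊕ s.
module Splitting (k : ℕ) where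
  open SignedMap {suc k} {k} (λ _ → zero) (remainder {2} (2 ^ k))
    using () renaming (reindex to deleteBit; reindex-selfDualBent to deleteBit-selfDualBent)
  open SignedMap {suc k} {0} (quotient {2} (2 ^ k)) (λ _ → zero)
    using () renaming (reindex to xorTopBits; reindex-selfDualBent to xorTopBits-selfDualBent)

  deleteBit-xorTopBits-injective : ∀ {i j} → deleteBit i ≡ deleteBit j → xorTopBits i ≡ xorTopBits j → i ≡ j
  deleteBit-xorTopBits-injective {i} {j} d≡ x≡ = quotient-remainder-injective {2} (2 ^ suc k) s≡ p≡
    where
    s b : Fin (2 ^ suc (suc k)) → Fin 2
    s = quotient {2} (2 ^ suc k)
    b = quotient {2} (2 ^ k) ∘ remainder {2} (2 ^ suc k)
    r : Fin (2 ^ suc (suc k)) → Fin (2 ^ k)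
    r = remainder {2} (2 ^ k) ∘ remainder {2} (2 ^ suc k)
    s≡ : s i ≡ s j
    s≡ = combine-injectiveˡ (s i) (r i) (s j) (r j) d≡
    b≡ : b i ≡ b j
    b≡ = ⊕-cancelʳ (s i) (trans (combine-injectiveˡ (b i ⊕ s i) zero (b j ⊕ s j) zero x≡) (cong (b j ⊕_) (sym s≡)))
    p≡ : remainder {2} (2 ^ suc k) i ≡ remainder {2} (2 ^ suc k) j
    p≡ = quotient-remainder-injective {2} (2 ^ k) b≡ (combine-injectiveʳ (s i) (r i) (s j) (r j) d≡)

  numSB[2+k]≤numSB[1+k]*numSB[1] : ∀ n h → numSB (suc (suc k)) n h ≤ numSB (suc k) n h * numSB 1 n h
  numSB[2+k]≤numSB[1+k]*numSB[1] n h = numSB-≤-* {suc (suc k)} {suc k} {1} n h deleteBit xorTopBits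
    (λ {f} → deleteBit-selfDualBent {n} {h} {f}) (λ {f} → xorTopBits-selfDualBent {n} {h} {f})
    deleteBit-xorTopBits-injective

numSB-≤-^ : ∀ k n h → numSB (suc k) n h ≤ numSB 1 n h ^ suc k
numSB-≤-^ zero    n h = ≤-reflexive (sym (*-identityʳ _))
numSB-≤-^ (suc k) n h = begin
  numSB (suc (suc k)) n h           ≤⟨ Splitting.numSB[2+k]≤numSB[1+k]*numSB[1] k n h ⟩
  numSB (suc k) n h * numSB 1 n h   ≤⟨ *-monoˡ-≤ (numSB 1 n h) (numSB-≤-^ k n h) ⟩
  numSB 1 n h ^ suc k * numSB 1 n h ≡⟨ *-comm (numSB 1 n h ^ suc k) (numSB 1 n h) ⟩
  numSB 1 n h ^ suc (suc k)         ∎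
  where open ≤-Reasoning

-- The bound holds for every n and h.
proposition6 : (k n h : ℕ) → 1 ≤ k → 0 < n → n ≡ 2 * h →
    numSB k n h ≤ numSB 1 n h ^ k
proposition6 (suc k) n h _ _ _ = numSB-≤-^ k n h
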